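{- In any extensional $\mathbf{BI}(\_)^\bullet$-algebra $\mathcal{A}$ the following hold for all $a,b\in\mathcal{A}$ and $l,m,n\ge0$: (1) $\mathbf{B}:2\rightarrow1$, $\mathbf{I}:0\rightarrow0$ and $a^\bullet:0\rightarrow1$; (2) if $a:l\rightarrow m$ and $b:m\rightarrow n$ then $a\circ b:l\rightarrow n$; (3) if $a:m\rightarrow n$ then $\mathbf{B}\,a:m+1\rightarrow n+1$, and moreover $\mathbf{B}\,\mathbf{I}=\mathbf{I}$ and $\mathbf{B}\,(a\circ b)=(\mathbf{B}\,a)\circ(\mathbf{B}\,b)$; (4) if $a:m\rightarrow n$ then $a:m+1\rightarrow n+1$; (5) if $a:m\rightarrow n$ then $(\mathbf{B}^m\,b)\circ a=a\circ(\mathbf{B}^n\,b)$.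
   Context: An extensional $\mathbf{BI}(\_)^\bullet$-algebra is a set $\mathcal{A}$ with a binary application written by juxtaposition (left associative), elements $\mathbf{B},\mathbf{I}$ and a function $a\mapsto a^\bullet$ such that for all $a,b,c$: $\mathbf{I}\,a=a$; $\mathbf{B}\,a\,b\,c=a\,(b\,c)$; $a^\bullet\,b=b\,a$; $\mathbf{B}\,\mathbf{I}=\mathbf{I}$; $(a\,b)^\bullet=\mathbf{B}\,b^\bullet\,(\mathbf{B}\,a^\bullet\,\mathbf{B})$; $\mathbf{B}\,\mathbf{B}^\bullet\,(\mathbf{B}\,\mathbf{B}\,(\mathbf{B}\,\mathbf{B}\,\mathbf{B}))=\mathbf{B}\,(\mathbf{B}\,\mathbf{B})\,\mathbf{B}$; $\mathbf{B}\,\mathbf{I}^\bullet\,\mathbf{B}=\mathbf{I}$; $\mathbf{B}\,a^{\bullet\bullet}\,\mathbf{B}=\mathbf{B}\,(\mathbf{B}\,a^\bullet)\,\mathbf{B}$. Write $a\circ b=\mathbf{B}\,a\,b$ (associative with unit $\mathbf{I}$ in such algebras). Let $\mathbf{B}^0=\mathbf{I}$, $\mathbf{B}^{k+1}=\mathbf{B}\circ\mathbf{B}^k$. An element $a$ is of arity $m\rightarrow n$, written $a:m\rightarrow n$, when $a^\bullet\circ\mathbf{B}^{m+1}=(\mathbf{B}\,a)\circ\mathbf{B}^n$. -}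

module Defs where

open import Data.Nat using (ℕ; zero; suc)
open import Relation.Binary.PropositionalEquality using (_≡_)

record BIAlgebra : Set₁ where
  infixl 9 _∙_
  field
    Carrier : Set
    _∙_ : Carrier → Carrier → Carrier
    B : Carrier
    I : Carrier
    _• : Carrier → Carrier
    I-ax : ∀ a → I ∙ a ≡ a
    B-ax : ∀ a b c → B ∙ a ∙ b ∙ c ≡ a ∙ (b ∙ c)
    •-ax : ∀ a b → (a •) ∙ b ≡ b ∙ a
    BI≡I : B ∙ I ≡ I
    •-app : ∀ a b → ((a ∙ b) •) ≡ B ∙ (b •) ∙ (B ∙ (a •) ∙ B)
    B-assoc : B ∙ (B •) ∙ (B ∙ B ∙ (B ∙ B ∙ B)) ≡ B ∙ (B ∙ B) ∙ B
    I•-ax : B ∙ (I •) ∙ B ≡ I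
    ••-ax : ∀ a → B ∙ ((a •) •) ∙ B ≡ B ∙ (B ∙ (a •)) ∙ B

module _ (𝒜 : BIAlgebra) where
  open BIAlgebra 𝒜

  _∘B_ : Carrier → Carrier → Carrier
  a ∘B b = B ∙ a ∙ b

  Bpow : ℕ → Carrier
  Bpow zero = I
  Bpow (suc k) = B ∘B Bpow k

  HasArity : Carrier → ℕ → ℕ → Set
  HasArity a m n = ((a •) ∘B Bpow (suc m)) ≡ ((B ∙ a) ∘B Bpow n)

{-# OPTIONS --safe #-}
-- B is a monoid endomorphism of (𝒜, ∘, I), which makes ∘ associative.  Unfolding
-- the definition pointwise, a : m → n says that a commutes past B^m b, turning it
-- into B^n b; for B (arity 2 → 1) and a • (arity 0 → 1) this gives the two sliding
-- rules  B ∘ B a = B (B a) ∘ B  and  x ∘ a • = a • ∘ B x.  With  (B a)• = a • ∘ B • ∘ B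
-- and  (a ∘ b)• = b • ∘ (B a)• ∘ B,  these reduce the arity of B a to that of a, and
-- the arity of a ∘ b to those of B a and b.
module Submission where

open import Defs
open import Data.Nat using (ℕ; zero; suc; _+_)
open import Data.Nat.Properties using (+-comm)
open import Data.Product using (_×_; _,_)
open import Relation.Binary.PropositionalEquality
  using (_≡_; sym; trans; cong; subst₂; module ≡-Reasoning)

module _ (𝒜 : BIAlgebra) where
  open BIAlgebra 𝒜
  open ≡-Reasoning

  infixr 5 _∘_
  _∘_ : Carrier → Carrier → Carrier
  _∘_ = _∘B_ 𝒜

  B^ : ℕ → Carrier
  B^ = Bpow 𝒜

  B-∘ : ∀ a b → B ∙ (a ∘ b) ≡ B ∙ a ∘ B ∙ b
  B-∘ a b = begin
    B ∙ (B ∙ a ∙ b)                           ≡⟨ sym (B-ax B (B ∙ a) b) ⟩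
    B ∙ B ∙ (B ∙ a) ∙ b                       ≡⟨ cong (_∙ b) (sym (B-ax (B ∙ B) B a)) ⟩
    B ∙ (B ∙ B) ∙ B ∙ a ∙ b                   ≡⟨ cong (λ z → z ∙ a ∙ b) (sym B-assoc) ⟩
    B ∙ (B •) ∙ (B ∙ B ∙ (B ∙ B ∙ B)) ∙ a ∙ b ≡⟨ cong (_∙ b) (B-ax (B •) _ a) ⟩
    (B •) ∙ (B ∙ B ∙ (B ∙ B ∙ B) ∙ a) ∙ b     ≡⟨ cong (_∙ b) (•-ax B _) ⟩
    B ∙ B ∙ (B ∙ B ∙ B) ∙ a ∙ B ∙ b           ≡⟨ cong (λ z → z ∙ B ∙ b) (B-ax B (B ∙ B ∙ B) a) ⟩
    B ∙ (B ∙ B ∙ B ∙ a) ∙ B ∙ b               ≡⟨ B-ax (B ∙ B ∙ B ∙ a) B b ⟩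
    B ∙ B ∙ B ∙ a ∙ (B ∙ b)                   ≡⟨ cong (_∙ (B ∙ b)) (B-ax B B a) ⟩
    B ∙ (B ∙ a) ∙ (B ∙ b)                     ∎

  ∘-assoc : ∀ a b c → (a ∘ b) ∘ c ≡ a ∘ (b ∘ c)
  ∘-assoc a b c = trans (cong (_∙ c) (B-∘ a b)) (B-ax (B ∙ a) (B ∙ b) c)

  ∘-identityˡ : ∀ a → I ∘ a ≡ a
  ∘-identityˡ a = trans (cong (_∙ a) BI≡I) (I-ax a)

  ∘-identityʳ : ∀ a → a ∘ I ≡ a
  ∘-identityʳ a = begin
    B ∙ a ∙ I         ≡⟨ sym (•-ax I (B ∙ a)) ⟩
    (I •) ∙ (B ∙ a)   ≡⟨ sym (B-ax (I •) B a) ⟩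
    B ∙ (I •) ∙ B ∙ a ≡⟨ cong (_∙ a) I•-ax ⟩
    I ∙ a             ≡⟨ I-ax a ⟩
    a                 ∎

  B^-+ : ∀ m n → B^ (m + n) ≡ B^ m ∘ B^ n
  B^-+ zero    n = sym (∘-identityˡ (B^ n))
  B^-+ (suc m) n = trans (cong (B ∘_) (B^-+ m n)) (sym (∘-assoc B (B^ m) (B^ n)))

  B^-suc-∙ : ∀ k b → B^ (suc k) ∙ b ≡ B ∙ (B^ k ∙ b)
  B^-suc-∙ k b = B-ax B (B^ k) b

  B^-1-∙ : ∀ b → B^ 1 ∙ b ≡ B ∙ b
  B^-1-∙ b = trans (B^-suc-∙ 0 b) (cong (B ∙_) (I-ax b))

  HasArity-commute : ∀ a b m n → HasArity 𝒜 a m n → (B^ m ∙ b) ∘ a ≡ a ∘ (B^ n ∙ b)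
  HasArity-commute a b m n a:m→n = begin
    B ∙ (B^ m ∙ b) ∙ a       ≡⟨ cong (_∙ a) (sym (B^-suc-∙ m b)) ⟩
    B^ (suc m) ∙ b ∙ a       ≡⟨ sym (•-ax a _) ⟩
    (a •) ∙ (B^ (suc m) ∙ b) ≡⟨ sym (B-ax (a •) _ b) ⟩
    ((a •) ∘ B^ (suc m)) ∙ b ≡⟨ cong (_∙ b) a:m→n ⟩
    (B ∙ a ∘ B^ n) ∙ b       ≡⟨ B-ax (B ∙ a) _ b ⟩
    B ∙ a ∙ (B^ n ∙ b)       ∎

  HasArity-+ʳ : ∀ a m n k → HasArity 𝒜 a m n → HasArity 𝒜 a (m + k) (n + k)
  HasArity-+ʳ a m n k a:m→n = begin
    (a •) ∘ B^ (suc m + k)       ≡⟨ cong ((a •) ∘_) (B^-+ (suc m) k) ⟩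
    (a •) ∘ (B^ (suc m) ∘ B^ k)  ≡⟨ sym (∘-assoc (a •) _ _) ⟩
    ((a •) ∘ B^ (suc m)) ∘ B^ k  ≡⟨ cong (_∘ B^ k) a:m→n ⟩
    (B ∙ a ∘ B^ n) ∘ B^ k        ≡⟨ ∘-assoc (B ∙ a) _ _ ⟩
    B ∙ a ∘ (B^ n ∘ B^ k)        ≡⟨ cong (B ∙ a ∘_) (sym (B^-+ n k)) ⟩
    B ∙ a ∘ B^ (n + k)           ∎

  B-HasArity : HasArity 𝒜 B 2 1
  B-HasArity = begin
    (B •) ∘ B ∘ B ∘ B ∘ I ≡⟨ cong (λ z → (B •) ∘ B ∘ B ∘ z) (∘-identityʳ B) ⟩
    (B •) ∘ B ∘ B ∘ B     ≡⟨ B-assoc ⟩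
    B ∙ B ∘ B             ≡⟨ cong (B ∙ B ∘_) (sym (∘-identityʳ B)) ⟩
    B ∙ B ∘ B ∘ I         ∎

  I-HasArity : HasArity 𝒜 I 0 0
  I-HasArity = begin
    (I •) ∘ B ∘ I ≡⟨ cong ((I •) ∘_) (∘-identityʳ B) ⟩
    (I •) ∘ B     ≡⟨ I•-ax ⟩
    I             ≡⟨ sym BI≡I ⟩
    B ∙ I         ≡⟨ sym (∘-identityʳ (B ∙ I)) ⟩
    B ∙ I ∘ I     ∎

  •-HasArity : ∀ a → HasArity 𝒜 (a •) 0 1
  •-HasArity a = begin
    ((a •) •) ∘ B ∘ I ≡⟨ cong (((a •) •) ∘_) (∘-identityʳ B) ⟩
    ((a •) •) ∘ B     ≡⟨ ••-ax a ⟩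
    B ∙ (a •) ∘ B     ≡⟨ cong (B ∙ (a •) ∘_) (sym (∘-identityʳ B)) ⟩
    B ∙ (a •) ∘ B ∘ I ∎

  •-slide : ∀ a x → x ∘ (a •) ≡ (a •) ∘ B ∙ x
  •-slide a x = begin
    x ∘ (a •)            ≡⟨ cong (_∘ (a •)) (sym (I-ax x)) ⟩
    (I ∙ x) ∘ (a •)      ≡⟨ HasArity-commute (a •) x 0 1 (•-HasArity a) ⟩
    (a •) ∘ (B^ 1 ∙ x)   ≡⟨ cong ((a •) ∘_) (B^-1-∙ x) ⟩
    (a •) ∘ B ∙ x        ∎

  B-slide : ∀ a → B ∘ B ∙ a ≡ B ∙ (B ∙ a) ∘ B
  B-slide a = begin
    B ∘ B ∙ a            ≡⟨ cong (B ∘_) (sym (B^-1-∙ a)) ⟩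
    B ∘ (B^ 1 ∙ a)       ≡⟨ sym (HasArity-commute B a 2 1 B-HasArity) ⟩
    (B^ 2 ∙ a) ∘ B       ≡⟨ cong (_∘ B) (trans (B^-suc-∙ 1 a) (cong (B ∙_) (B^-1-∙ a))) ⟩
    B ∙ (B ∙ a) ∘ B      ∎

  B-• : ∀ a → (B ∙ a) • ≡ (a •) ∘ (B •) ∘ B
  B-• a = •-app B a

  ∘-• : ∀ a b → (a ∘ b) • ≡ (b •) ∘ ((B ∙ a) •) ∘ B
  ∘-• a b = •-app (B ∙ a) b

  B-HasArity-suc : ∀ a m n → HasArity 𝒜 a m n → HasArity 𝒜 (B ∙ a) (suc m) (suc n)
  B-HasArity-suc a m n a:m→n = begin
    ((B ∙ a) •) ∘ B^ (2 + m)         ≡⟨ cong (_∘ B^ (2 + m)) (B-• a) ⟩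
    ((a •) ∘ (B •) ∘ B) ∘ B^ (2 + m) ≡⟨ ∘-assoc (a •) _ _ ⟩
    (a •) ∘ ((B •) ∘ B) ∘ B^ (2 + m) ≡⟨ cong ((a •) ∘_) (∘-assoc (B •) B _) ⟩
    (a •) ∘ (B •) ∘ B^ (3 + m)       ≡⟨ cong ((a •) ∘_) (HasArity-+ʳ B 2 1 m B-HasArity) ⟩
    (a •) ∘ B ∙ B ∘ B^ (1 + m)       ≡⟨ sym (∘-assoc (a •) _ _) ⟩
    ((a •) ∘ B ∙ B) ∘ B^ (1 + m)     ≡⟨ cong (_∘ B^ (1 + m)) (sym (•-slide a B)) ⟩
    (B ∘ (a •)) ∘ B^ (1 + m)         ≡⟨ ∘-assoc B (a •) _ ⟩
    B ∘ (a •) ∘ B^ (1 + m)           ≡⟨ cong (B ∘_) a:m→n ⟩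
    B ∘ B ∙ a ∘ B^ n                 ≡⟨ sym (∘-assoc B (B ∙ a) _) ⟩
    (B ∘ B ∙ a) ∘ B^ n               ≡⟨ cong (_∘ B^ n) (B-slide a) ⟩
    (B ∙ (B ∙ a) ∘ B) ∘ B^ n         ≡⟨ ∘-assoc _ B _ ⟩
    B ∙ (B ∙ a) ∘ B^ (1 + n)         ∎

  ∘-HasArity : ∀ a b l m n → HasArity 𝒜 a l m → HasArity 𝒜 b m n → HasArity 𝒜 (a ∘ b) l n
  ∘-HasArity a b l m n a:l→m b:m→n = begin
    ((a ∘ b) •) ∘ B^ (1 + l)               ≡⟨ cong (_∘ B^ (1 + l)) (∘-• a b) ⟩
    ((b •) ∘ ((B ∙ a) •) ∘ B) ∘ B^ (1 + l) ≡⟨ ∘-assoc (b •) _ _ ⟩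
    (b •) ∘ (((B ∙ a) •) ∘ B) ∘ B^ (1 + l) ≡⟨ cong ((b •) ∘_) (∘-assoc ((B ∙ a) •) B _) ⟩
    (b •) ∘ ((B ∙ a) •) ∘ B^ (2 + l)       ≡⟨ cong ((b •) ∘_) (B-HasArity-suc a l m a:l→m) ⟩
    (b •) ∘ B ∙ (B ∙ a) ∘ B^ (1 + m)       ≡⟨ sym (∘-assoc (b •) _ _) ⟩
    ((b •) ∘ B ∙ (B ∙ a)) ∘ B^ (1 + m)     ≡⟨ cong (_∘ B^ (1 + m)) (sym (•-slide b (B ∙ a))) ⟩
    (B ∙ a ∘ (b •)) ∘ B^ (1 + m)           ≡⟨ ∘-assoc (B ∙ a) (b •) _ ⟩
    B ∙ a ∘ (b •) ∘ B^ (1 + m)             ≡⟨ cong (B ∙ a ∘_) b:m→n ⟩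
    B ∙ a ∘ B ∙ b ∘ B^ n                   ≡⟨ sym (∘-assoc (B ∙ a) (B ∙ b) _) ⟩
    (B ∙ a ∘ B ∙ b) ∘ B^ n                 ≡⟨ cong (_∘ B^ n) (sym (B-∘ a b)) ⟩
    B ∙ (a ∘ b) ∘ B^ n                     ∎

  B-HasArity-+1 : ∀ a m n → HasArity 𝒜 a m n → HasArity 𝒜 (B ∙ a) (m + 1) (n + 1)
  B-HasArity-+1 a m n a:m→n =
    subst₂ (HasArity 𝒜 (B ∙ a)) (+-comm 1 m) (+-comm 1 n) (B-HasArity-suc a m n a:m→n)

lemma4p3 : (𝒜 : BIAlgebra) →
    let open BIAlgebra 𝒜 in
    ((HasArity 𝒜 B 2 1 × HasArity 𝒜 I 0 0 × (∀ a → HasArity 𝒜 (a •) 0 1))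
    × (∀ a b l m n → HasArity 𝒜 a l m → HasArity 𝒜 b m n → HasArity 𝒜 (_∘B_ 𝒜 a b) l n)
    × ((∀ a m n → HasArity 𝒜 a m n → HasArity 𝒜 (B ∙ a) (m + 1) (n + 1))
       × (B ∙ I ≡ I)
       × (∀ a b → B ∙ (_∘B_ 𝒜 a b) ≡ _∘B_ 𝒜 (B ∙ a) (B ∙ b)))
    × (∀ a m n → HasArity 𝒜 a m n → HasArity 𝒜 a (m + 1) (n + 1))
    × (∀ a b m n → HasArity 𝒜 a m n → _∘B_ 𝒜 (Bpow 𝒜 m ∙ b) a ≡ _∘B_ 𝒜 a (Bpow 𝒜 n ∙ b)))
lemma4p3 𝒜 =
    (B-HasArity 𝒜 , I-HasArity 𝒜 , •-HasArity 𝒜)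
  , ∘-HasArity 𝒜
  , (B-HasArity-+1 𝒜 , BIAlgebra.BI≡I 𝒜 , B-∘ 𝒜)
  , (λ a m n → HasArity-+ʳ 𝒜 a m n 1)
  , HasArity-commute 𝒜
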